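{- Let $k\geq 1$ and let $M$ be a set of $n\geq 2$ positive integers. For every tree $T\in\mathcal{T}_M(k)$ without young leaves, $\mathrm{oint}(T)=n-2\,\mathrm{oleaf}(T)$.
   Context: Trees: all trees are ordered (plane) rooted trees; the level of a node is its distance from the root (root at level 0); a leaf is a node with no children. An even $k$-ary tree is an ordered tree in which every node on an even level has exactly $k$ children. A pruned even $k$-ary tree is obtained from an even $k$-ary tree by deleting, for every even-level node all of whose children are leaves, all those children. An increasing pruned even $k$-ary tree on $M$ is a pruned even $k$-ary tree whose nodes on even levels are labeled bijectively by $M$ (odd-level nodes unlabeled) such that labels increase along every path from the root downward and, for each node, the labels of its children increase from left to right; $\mathcal{T}_M(k)$ is the set of them. A labeled node is a leaf if it has no children and an internal node otherwise. For a labeled node $v$, its grand parent is the labeled node $u$ such that a child of $u$ is the parent of $v$. A labeled non-root node $v$ is old if its label is the greatest among all grand children of its grand parent, and young otherwise; the root is neither. $\mathrm{oint}(T)$ is the number of old internal nodes and $\mathrm{oleaf}(T)$ the number of old leaves of $T$. -}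

module Defs where

open import Data.Nat using (ℕ; _<_; _≤_; _+_; _*_)
open import Data.List using (List; []; _∷_; _++_; map; concat; length; filter)
open import Data.List.Relation.Unary.All using (All)
open import Data.List.Relation.Unary.All.Properties using ()
open import Data.List.Relation.Unary.Any using (Any)
open import Data.List.Relation.Unary.Linked using (Linked)
open import Data.List.Relation.Unary.Unique.Propositional using (Unique)
open import Data.List.Relation.Binary.Permutation.Propositional using (_↭_)
open import Data.List.Membership.Propositional using (_∈_)
open import Data.Vec using (Vec; toList)
open import Data.Product using (_×_)
open import Data.Unit using (⊤)
open import Data.Empty using (⊥)
open import Relation.Nullary using (¬_; Dec; yes; no)
open import Relation.Nullary.Decidable using (_×-dec_)
open import Relation.Binary.PropositionalEquality using (_≡_)
import Data.List.Relation.Unary.All as AllM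
import Data.Nat.Properties as NP

-- Only the labeled (even-level)
-- nodes are represented explicitly:
--   * leaf x      : an even-level node labeled x with no children
--                   (its k leaf-children were pruned away);
--   * inner x cs  : an even-level node labeled x with exactly k children
--                   (odd-level, unlabeled nodes); the i-th odd child is
--                   represented by the ordered list of its own children
--                   (even-level labeled subtrees), possibly empty.
data PTree (k : ℕ) : Set where
  leaf  : ℕ → PTree k
  inner : ℕ → Vec (List (PTree k)) k → PTree k

module _ {k : ℕ} where

  label : PTree k → ℕ
  label (leaf x)    = x
  label (inner x _) = x

  IsLeaf : PTree k → Set
  IsLeaf (leaf _)    = ⊤
  IsLeaf (inner _ _) = ⊥

  IsInternal : PTree k → Set
  IsInternal t = ¬ IsLeaf t

  isLeaf? : (t : PTree k) → Dec (IsLeaf t)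
  isLeaf? (leaf _)    = yes _
  isLeaf? (inner _ _) = no (λ ())

  isInternal? : (t : PTree k) → Dec (IsInternal t)
  isInternal? (leaf _)    = no (λ f → f _)
  isInternal? (inner _ _) = yes (λ ())

  oddChildren : PTree k → List (List (PTree k))
  oddChildren (leaf _)     = []
  oddChildren (inner _ cs) = toList cs

  grandchildren : PTree k → List (PTree k)
  grandchildren t = concat (oddChildren t)

  mutual
    nodes : PTree k → List (PTree k)
    nodes t@(leaf _)     = t ∷ []
    nodes t@(inner _ cs) = t ∷ nodesV cs

    nodesV : ∀ {m} → Vec (List (PTree k)) m → List (PTree k)
    nodesV Vec.[]       = []
    nodesV (l Vec.∷ ls) = nodesL l ++ nodesV ls

    nodesL : List (PTree k) → List (PTree k)
    nodesL []       = []
    nodesL (t ∷ ts) = nodes t ++ nodesL ts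

  -- Pruned: no labeled node has k children that are all leaves
  -- (every internal labeled node has an odd child with at least one child).
  Pruned : PTree k → Set
  Pruned T = All (λ u → IsInternal u → Any (λ l → ¬ l ≡ []) (oddChildren u)) (nodes T)

  Increasing : PTree k → Set
  Increasing T = All (λ u → All (λ v → label u < label v) (grandchildren u)
                          × All (λ l → Linked _<_ (map label l)) (oddChildren u))
                     (nodes T)

  LabeledBy : PTree k → List ℕ → Set
  LabeledBy T M = map label (nodes T) ↭ M

  IsOld : PTree k → List (PTree k) → Set
  IsOld v g = All (λ w → label w ≤ label v) g

  isOld? : (v : PTree k) (g : List (PTree k)) → Dec (IsOld v g)
  isOld? v g = AllM.all? (λ w → label w NP.≤? label v) g

  oldInternalsAt : PTree k → ℕ
  oldInternalsAt u =
    length (filter (λ v → isOld? v (grandchildren u) ×-dec isInternal? v) (grandchildren u))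

  oldLeavesAt : PTree k → ℕ
  oldLeavesAt u =
    length (filter (λ v → isOld? v (grandchildren u) ×-dec isLeaf? v) (grandchildren u))

  sumℕ : List ℕ → ℕ
  sumℕ []       = 0
  sumℕ (x ∷ xs) = x + sumℕ xs

  oint : PTree k → ℕ
  oint T = sumℕ (map oldInternalsAt (nodes T))

  oleaf : PTree k → ℕ
  oleaf T = sumℕ (map oldLeavesAt (nodes T))

  NoYoungLeaves : PTree k → Set
  NoYoungLeaves T =
    All (λ u → All (λ v → IsLeaf v → IsOld v (grandchildren u)) (grandchildren u)) (nodes T)

  InTM : List ℕ → PTree k → Set
  InTM M T = Pruned T × Increasing T × LabeledBy T M

-- Every labeled non-root node is a grand child of exactly one labeled node,
-- and the root is internal because n ≥ 2.  At an internal node u the grand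
-- children are nonempty (pruning) with distinct labels, so exactly one of them
-- is old; since there are no young leaves, every leaf grand child of u is old.
-- Hence oint T + oleaf T counts the internal nodes and oleaf T counts the
-- leaves, which together are the n nodes of T.
module Submission where

open import Defs
open import Algebra.Bundles using (CommutativeMonoid)
import Algebra.Properties.CommutativeSemigroup as CommutativeSemigroupProperties
open import Data.Nat using (ℕ; _≤_; _<_; _+_; _*_; suc; s≤s; z≤n)
open import Data.Nat.ListAction using (sum)
open import Data.Nat.Properties
  using (≤-antisym; ≤-reflexive; ≤-totalOrder; +-assoc; +-identityʳ; +-suc; 1+n≰n; +-commutativeSemigroup)
open import Data.List using (List; []; _∷_; [_]; _++_; map; concat; concatMap; length; filter)
open import Data.List.Properties
  using (filter-++; filter-none; length-++; length-map; map-++; concat-++; concat-map-[_]; map-cong-local; ++-conicalˡ; ++-conicalʳ)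
open import Data.List.Extrema ≤-totalOrder using (argmax; argmax-all; f[⊥]≤f[argmax]; f[xs]≤f[argmax])
open import Data.List.Membership.Propositional using (_∈_)
open import Data.List.Membership.Propositional.Properties using (∈-filter⁺; ∈-length)
open import Data.List.Relation.Unary.All using (All; []; _∷_; lookup; tabulate)
import Data.List.Relation.Unary.All as All
import Data.List.Relation.Unary.All.Properties as All
open import Data.List.Relation.Unary.Any using (Any; here; there)
open import Data.List.Relation.Unary.AllPairs using (AllPairs; []; _∷_)
open import Data.List.Relation.Unary.Unique.Propositional using (Unique)
open import Data.List.Relation.Binary.Permutation.Propositional
  using (_↭_; ↭-refl; ↭-sym; prep; ↭⇒↭ₛ; module PermutationReasoning)
open import Data.List.Relation.Binary.Permutation.Propositional.Properties
  using (++⁺; ↭-length; filter-↭; ++-commutativeMonoid)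
import Data.List.Relation.Binary.Permutation.Propositional.Properties as Permutation
import Data.List.Relation.Binary.Permutation.Setoid.Properties as PermutationSetoid
open import Data.List.Relation.Binary.Sublist.Propositional using (_⊆_; []; _∷_; _∷ʳ_)
open import Data.List.Relation.Binary.Sublist.Propositional.Properties using (All-resp-⊆; all⊆concat)
import Data.List.Relation.Binary.Sublist.Propositional.Properties as Sublist
open import Data.Vec using (Vec; toList)
open import Data.Product using (_,_)
open import Data.Empty using (⊥-elim)
open import Function using (_∘_)
open import Level using (Level)
open import Relation.Binary using (Rel)
open import Relation.Binary.PropositionalEquality
  using (_≡_; refl; sym; trans; cong; cong₂; subst; setoid; module ≡-Reasoning)
open import Relation.Nullary using (¬_; yes; no)
open import Relation.Nullary.Decidable using (_×-dec_)
open import Relation.Unary using (Pred; Decidable)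

private
  variable
    ℓ : Level
    A B : Set
    x : A
    xs ys as bs : List A

open CommutativeSemigroupProperties +-commutativeSemigroup using () renaming (interchange to +-interchange)

Unique-resp-↭ : xs ↭ ys → Unique xs → Unique ys
Unique-resp-↭ p = PermutationSetoid.Unique-resp-↭ (setoid _) (↭⇒↭ₛ p)

AllPairs-resp-⊆ : {R : Rel A ℓ} → xs ⊆ ys → AllPairs R ys → AllPairs R xs
AllPairs-resp-⊆ []         []       = []
AllPairs-resp-⊆ (_ ∷ʳ τ)   (_ ∷ rs) = AllPairs-resp-⊆ τ rs
AllPairs-resp-⊆ (refl ∷ τ) (r ∷ rs) = All-resp-⊆ τ r ∷ AllPairs-resp-⊆ τ rs

concat-≢[] : {xss : List (List A)} → Any (λ l → ¬ l ≡ []) xss → ¬ concat xss ≡ []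
concat-≢[] {xss = xs ∷ _}  (here xs≢[]) eq = xs≢[] (++-conicalˡ xs _ eq)
concat-≢[] {xss = xs ∷ _}  (there any)  eq = concat-≢[] any (++-conicalʳ xs _ eq)

sum-map-+ : (f g : A → ℕ) (xs : List A) →
            sum (map (λ x → f x + g x) xs) ≡ sum (map f xs) + sum (map g xs)
sum-map-+ f g []       = refl
sum-map-+ f g (x ∷ xs) =
  trans (cong (f x + g x +_) (sum-map-+ f g xs)) (+-interchange (f x) (g x) _ _)

concatMap-++ : (f : A → List B) (xs ys : List A) →
               concatMap f (xs ++ ys) ≡ concatMap f xs ++ concatMap f ys
concatMap-++ f xs ys = trans (cong concat (map-++ f xs ys)) (sym (concat-++ (map f xs) (map f ys)))

↭-concatMap-++ : (f : A → List A) →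
                 xs ↭ as ++ concatMap f xs → ys ↭ bs ++ concatMap f ys →
                 xs ++ ys ↭ (as ++ bs) ++ concatMap f (xs ++ ys)
↭-concatMap-++ {xs = xs} {as = as} {ys = ys} {bs = bs} f xs↭ ys↭ = begin
  xs ++ ys                                           ↭⟨ ++⁺ xs↭ ys↭ ⟩
  (as ++ concatMap f xs) ++ (bs ++ concatMap f ys)   ↭⟨ ++-interchange as _ bs _ ⟩
  (as ++ bs) ++ (concatMap f xs ++ concatMap f ys)   ≡⟨ cong ((as ++ bs) ++_) (concatMap-++ f xs ys) ⟨
  (as ++ bs) ++ concatMap f (xs ++ ys)               ∎
  where
    open PermutationReasoning
    open CommutativeSemigroupProperties
      (CommutativeMonoid.commutativeSemigroup ++-commutativeMonoid)
      using () renaming (interchange to ++-interchange)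

module _ {P : Pred A ℓ} (P? : Decidable P) where

  count : List A → ℕ
  count xs = length (filter P? xs)

  count-++ : (xs ys : List A) → count (xs ++ ys) ≡ count xs + count ys
  count-++ xs ys = trans (cong length (filter-++ P? xs ys)) (length-++ (filter P? xs))

  count-concatMap : (f : B → List A) (bs : List B) →
                    count (concatMap f bs) ≡ sum (map (count ∘ f) bs)
  count-concatMap f []       = refl
  count-concatMap f (b ∷ bs) =
    trans (count-++ (f b) (concatMap f bs)) (cong (count (f b) +_) (count-concatMap f bs))

  count-↭ : xs ↭ ys → count xs ≡ count ys
  count-↭ p = ↭-length (filter-↭ P? p)

  ∈⇒1≤count : x ∈ xs → P x → 1 ≤ count xs
  ∈⇒1≤count x∈xs px = ∈-length (∈-filter⁺ P? x∈xs px)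

  count≤1 : {C : Set} (f : A → C) → Unique (map f xs) →
            (∀ {x y} → x ∈ xs → y ∈ xs → P x → P y → f x ≡ f y) → count xs ≤ 1
  count≤1 {xs = []}     f _                    _    = z≤n
  count≤1 {xs = x ∷ xs} f (fx∉fxs ∷ injective) same with P? x
  ... | yes px = s≤s (≤-reflexive (cong length (filter-none P? noneP)))
    where
      noneP : All (λ y → ¬ P y) xs
      noneP = tabulate λ y∈xs py →
        lookup (All.map⁻ fx∉fxs) y∈xs (same (here refl) (there y∈xs) px py)
  ... | no _   = count≤1 f injective (λ x∈ y∈ → same (there x∈) (there y∈))

count-×-dec-implied : {P Q : Pred A ℓ} (P? : Decidable P) (Q? : Decidable Q) →
                      All (λ x → Q x → P x) xs →
                      count (λ x → P? x ×-dec Q? x) xs ≡ count Q? xs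
count-×-dec-implied P? Q? [] = refl
count-×-dec-implied {xs = x ∷ _} P? Q? (q⇒p ∷ rest) with P? x | Q? x
... | yes _ | yes _ = cong suc (count-×-dec-implied P? Q? rest)
... | no ¬p | yes q = ⊥-elim (¬p (q⇒p q))
... | yes _ | no _  = count-×-dec-implied P? Q? rest
... | no _  | no _  = count-×-dec-implied P? Q? rest

module _ {k : ℕ} where

  mutual
    nodes-↭ : (t : PTree k) → nodes t ↭ t ∷ concatMap grandchildren (nodes t)
    nodes-↭ (leaf _)     = ↭-refl
    nodes-↭ (inner _ cs) = prep _ (nodesV-↭ cs)

    nodesV-↭ : ∀ {m} (cs : Vec (List (PTree k)) m) →
               nodesV cs ↭ concat (toList cs) ++ concatMap grandchildren (nodesV cs)
    nodesV-↭ Vec.[]       = ↭-refl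
    nodesV-↭ (l Vec.∷ ls) = ↭-concatMap-++ grandchildren (nodesL-↭ l) (nodesV-↭ ls)

    nodesL-↭ : (ts : List (PTree k)) → nodesL ts ↭ ts ++ concatMap grandchildren (nodesL ts)
    nodesL-↭ []       = ↭-refl
    nodesL-↭ (t ∷ ts) = ↭-concatMap-++ grandchildren (nodes-↭ t) (nodesL-↭ ts)

  unique-grandchildren : (t : PTree k) → Unique (map label (nodes t)) →
                         All (λ u → Unique (map label (grandchildren u))) (nodes t)
  unique-grandchildren t unique = All.map
    (λ gc⊆ → AllPairs-resp-⊆ (Sublist.map⁺ label gc⊆) uniqueNonRoot)
    (All.map⁻ (all⊆concat (map grandchildren (nodes t))))
    where
      uniqueNonRoot : Unique (map label (concatMap grandchildren (nodes t)))
      uniqueNonRoot with Unique-resp-↭ (Permutation.map⁺ label (nodes-↭ t)) unique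
      ... | _ ∷ u = u

  count-internal+count-leaf : {P : Pred (PTree k) ℓ} (P? : Decidable P) (ts : List (PTree k)) →
    count (λ v → P? v ×-dec isInternal? v) ts + count (λ v → P? v ×-dec isLeaf? v) ts ≡ count P? ts
  count-internal+count-leaf P? [] = refl
  count-internal+count-leaf P? (t@(leaf _) ∷ ts) with P? t
  ... | yes _ = trans (+-suc _ _) (cong suc (count-internal+count-leaf P? ts))
  ... | no _  = count-internal+count-leaf P? ts
  count-internal+count-leaf P? (t@(inner _ _) ∷ ts) with P? t
  ... | yes _ = cong suc (count-internal+count-leaf P? ts)
  ... | no _  = count-internal+count-leaf P? ts

  internals+leaves : (ts : List (PTree k)) → count isInternal? ts + count isLeaf? ts ≡ length ts
  internals+leaves []                = refl
  internals+leaves (leaf _ ∷ ts)     = trans (+-suc _ _) (cong suc (internals+leaves ts))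
  internals+leaves (inner _ _ ∷ ts)  = cong suc (internals+leaves ts)

  count-old≡1 : (g : List (PTree k)) → ¬ g ≡ [] → Unique (map label g) →
           count (λ v → isOld? v g) g ≡ 1
  count-old≡1 []         g≢[] _      = ⊥-elim (g≢[] refl)
  count-old≡1 g@(x ∷ xs) _    unique = ≤-antisym
    (count≤1 (λ v → isOld? v g) label unique
      (λ v∈g w∈g vOld wOld → ≤-antisym (lookup wOld v∈g) (lookup vOld w∈g)))
    (∈⇒1≤count (λ v → isOld? v g) greatest∈g greatestOld)
    where
      greatest = argmax label x xs
      greatest∈g : greatest ∈ g
      greatest∈g = argmax-all label (here refl) (tabulate there)
      greatestOld : IsOld greatest g
      greatestOld = f[⊥]≤f[argmax] {f = label} x xs ∷ f[xs]≤f[argmax] x xs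

  oldInternalsAt+oldLeavesAt : (u : PTree k) →
    (IsInternal u → Any (λ l → ¬ l ≡ []) (oddChildren u)) →
    Unique (map label (grandchildren u)) →
    oldInternalsAt u + oldLeavesAt u ≡ count isInternal? [ u ]
  oldInternalsAt+oldLeavesAt (leaf _)       _      _      = refl
  oldInternalsAt+oldLeavesAt u@(inner _ cs) pruned unique =
    trans (count-internal+count-leaf (λ v → isOld? v g) g)
          (count-old≡1 g (concat-≢[] (pruned λ ())) unique)
    where g = grandchildren u

  oldLeavesAt≡leaves : (u : PTree k) →
    All (λ v → IsLeaf v → IsOld v (grandchildren u)) (grandchildren u) →
    oldLeavesAt u ≡ count isLeaf? (grandchildren u)
  oldLeavesAt≡leaves u = count-×-dec-implied (λ v → isOld? v (grandchildren u)) isLeaf?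

  sumℕ≡sum : (xs : List ℕ) → sumℕ {k} xs ≡ sum xs
  sumℕ≡sum []       = refl
  sumℕ≡sum (x ∷ xs) = cong (x +_) (sumℕ≡sum xs)

  oint+oleaf≡internals : (T : PTree k) → Pruned T → Unique (map label (nodes T)) →
                         oint T + oleaf T ≡ count isInternal? (nodes T)
  oint+oleaf≡internals T pruned unique = begin
    oint T + oleaf T
      ≡⟨ cong₂ _+_ (sumℕ≡sum (map oldInternalsAt N)) (sumℕ≡sum (map oldLeavesAt N)) ⟩
    sum (map oldInternalsAt N) + sum (map oldLeavesAt N)
      ≡⟨ sum-map-+ oldInternalsAt oldLeavesAt N ⟨
    sum (map (λ u → oldInternalsAt u + oldLeavesAt u) N)
      ≡⟨ cong sum (map-cong-local (All.zipWith (λ {u} (pu , uu) → oldInternalsAt+oldLeavesAt u pu uu)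
                                               (pruned , unique-grandchildren T unique))) ⟩
    sum (map (λ u → count isInternal? [ u ]) N)
      ≡⟨ count-concatMap isInternal? [_] N ⟨
    count isInternal? (concatMap [_] N)
      ≡⟨ cong (count isInternal?) (concat-map-[_] N) ⟩
    count isInternal? N ∎
    where
      open ≡-Reasoning
      N = nodes T

  oleaf≡leaves : (T : PTree k) → IsInternal T → NoYoungLeaves T →
                 oleaf T ≡ count isLeaf? (nodes T)
  oleaf≡leaves (leaf _)        internal _       = ⊥-elim (internal _)
  oleaf≡leaves T@(inner _ _)   _        noYoung = begin
    oleaf T                                       ≡⟨ sumℕ≡sum (map oldLeavesAt N) ⟩
    sum (map oldLeavesAt N)                       ≡⟨ cong sum (map-cong-local (All.map (λ {u} → oldLeavesAt≡leaves u) noYoung)) ⟩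
    sum (map (count isLeaf? ∘ grandchildren) N)   ≡⟨ count-concatMap isLeaf? grandchildren N ⟨
    count isLeaf? (T ∷ concatMap grandchildren N) ≡⟨ count-↭ isLeaf? (nodes-↭ T) ⟨
    count isLeaf? N                               ∎
    where
      open ≡-Reasoning
      N = nodes T

  length-nodes-leaf : (t : PTree k) → IsLeaf t → length (nodes t) ≡ 1
  length-nodes-leaf (leaf _) _ = refl

lemma4p3 : (k : ℕ) → 1 ≤ k → (n : ℕ) → 2 ≤ n →
           (M : List ℕ) → Unique M → All (λ m → 0 < m) M → length M ≡ n →
           (T : PTree k) → InTM M T → NoYoungLeaves T →
           oint T + 2 * oleaf T ≡ n
lemma4p3 k _ n 2≤n M uniqueM _ |M|≡n T (pruned , _ , labelledBy) noYoung = begin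
  oint T + 2 * oleaf T                  ≡⟨ cong (λ l → oint T + (oleaf T + l)) (+-identityʳ (oleaf T)) ⟩
  oint T + (oleaf T + oleaf T)          ≡⟨ +-assoc (oint T) _ _ ⟨
  (oint T + oleaf T) + oleaf T          ≡⟨ cong₂ _+_ (oint+oleaf≡internals T pruned uniqueN)
                                                     (oleaf≡leaves T rootInternal noYoung) ⟩
  count isInternal? N + count isLeaf? N ≡⟨ internals+leaves N ⟩
  length N                              ≡⟨ |N|≡n ⟩
  n                                     ∎
  where
    open ≡-Reasoning
    N = nodes T
    uniqueN : Unique (map label N)
    uniqueN = Unique-resp-↭ (↭-sym labelledBy) uniqueM
    |N|≡n : length N ≡ n
    |N|≡n = trans (sym (length-map label N)) (trans (↭-length labelledBy) |M|≡n)
    rootInternal : IsInternal T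
    rootInternal isLeaf = 1+n≰n (subst (2 ≤_) (trans (sym |N|≡n) (length-nodes-leaf T isLeaf)) 2≤n)
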